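{- Let $A[1..n]$ be an array of distinct elements from a totally ordered set and let $T$ be its Cartesian tree, whose nodes are identified with the indices $1,\ldots,n$. For any $i,j\in\{1,\ldots,n\}$ with $i<j$, let $v=\mathrm{RMQ}(i,j)$. Then $\mathrm{R2M}(i,j)$ is a node of the left inner spine of $v$ or of the right inner spine of $v$ in $T$.
   Context: $\mathrm{RMQ}(i,j)$ is the index of the smallest element of $A[i..j]$ and $\mathrm{R2M}(i,j)$ is the index of the second smallest element of $A[i..j]$. The Cartesian tree of $A$ is defined recursively: its root is labelled by the index $i$ with $A[i]$ minimal, its left subtree is the Cartesian tree of $A[1..i-1]$, its right subtree is the Cartesian tree of $A[i+1..n]$; nodes are identified with their labels (equivalently, their inorder ranks). The left spine of a node $u$ is the set of nodes on the downward path starting at $u$ (inclusive) that repeatedly follows left children as long as possible; the right spine is defined analogously with right children. The left inner spine of $u$ is the right spine of the left child of $u$ (empty if $u$ has no left child); the right inner spine of $u$ is the left spine of the right child of $u$ (empty if $u$ has no right child). -}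

module Defs where

open import Level using (Level; _⊔_)
open import Data.Nat using (ℕ; suc; _≤_; _<_)
open import Relation.Binary.Bundles using (StrictTotalOrder)
open import Relation.Binary.PropositionalEquality using (_≡_; _≢_)
open import Data.Product using (Σ; _×_)
open import Data.Sum using (_⊎_)

data Tree : Set where
  leaf : Tree
  node : Tree → ℕ → Tree → Tree

module _ {a ℓ₁ ℓ₂ : Level} (O : StrictTotalOrder a ℓ₁ ℓ₂) where
  open StrictTotalOrder O using (_≈_) renaming (Carrier to X; _<_ to _⊏_)

  Distinct : ℕ → (ℕ → X) → Set (ℓ₁)
  Distinct n A = ∀ p q → 1 ≤ p → p ≤ n → 1 ≤ q → q ≤ n → A p ≈ A q → p ≡ q

  -- IsCartesianTree A lo hi t : t is the Cartesian tree of the subarray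
  -- A[lo .. hi-1] (half-open range [lo, hi)); defined recursively as in the paper:
  -- empty range gives the empty tree; otherwise the root is the index k of the
  -- minimum, the left subtree is the Cartesian tree of A[lo..k-1] and the right
  -- subtree is the Cartesian tree of A[k+1..hi-1].
  data IsCartesianTree (A : ℕ → X) : ℕ → ℕ → Tree → Set (a ⊔ ℓ₂) where
    ct-leaf : ∀ {lo hi} → lo ≡ hi → IsCartesianTree A lo hi leaf
    ct-node : ∀ {lo hi k l r} → lo ≤ k → k < hi →
              (∀ m → lo ≤ m → m < hi → m ≢ k → A k ⊏ A m) →
              IsCartesianTree A lo k l →
              IsCartesianTree A (suc k) hi r →
              IsCartesianTree A lo hi (node l k r)

  IsRMQ : (ℕ → X) → ℕ → ℕ → ℕ → Set ℓ₂
  IsRMQ A i j v = i ≤ v × v ≤ j × (∀ m → i ≤ m → m ≤ j → m ≢ v → A v ⊏ A m)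

  IsR2M : (ℕ → X) → ℕ → ℕ → ℕ → Set ℓ₂
  IsR2M A i j w =
    i ≤ w × w ≤ j ×
    Σ ℕ (λ v → IsRMQ A i j v × w ≢ v ×
                (∀ m → i ≤ m → m ≤ j → m ≢ v → m ≢ w → A w ⊏ A m))

data Subtree : Tree → Tree → Set where
  here  : ∀ {t} → Subtree t t
  left  : ∀ {s l k r} → Subtree s l → Subtree s (node l k r)
  right : ∀ {s l k r} → Subtree s r → Subtree s (node l k r)

RootIs : Tree → ℕ → Set
RootIs leaf v = Data.Empty.⊥ where import Data.Empty
RootIs (node l k r) v = k ≡ v

data LeftSpine : Tree → ℕ → Set where
  ls-here : ∀ {l k r} → LeftSpine (node l k r) k
  ls-down : ∀ {l k r x} → LeftSpine l x → LeftSpine (node l k r) x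

data RightSpine : Tree → ℕ → Set where
  rs-here : ∀ {l k r} → RightSpine (node l k r) k
  rs-down : ∀ {l k r x} → RightSpine r x → RightSpine (node l k r) x

LeftInnerSpine : Tree → ℕ → Set
LeftInnerSpine leaf x = Data.Empty.⊥ where import Data.Empty
LeftInnerSpine (node l k r) x = RightSpine l x

RightInnerSpine : Tree → ℕ → Set
RightInnerSpine leaf x = Data.Empty.⊥ where import Data.Empty
RightInnerSpine (node l k r) x = LeftSpine r x

-- Descending from the root of the Cartesian tree, stop at the first node v whose index lies in
-- [i, j]; its subtree covers an interval [lo, hi) ⊇ [i, j], so v is the minimum of A[i..j].
-- The second minimum w ≠ v is then the minimum of A[i..v-1] or of A[v+1..j].  In the first case
-- w is a minimum of a suffix of the left child's interval [lo, v), and suffix minima of a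
-- Cartesian tree lie on its right spine; symmetrically, prefix minima lie on the left spine.
module Submission where

open import Defs
open import Level using (Level; _⊔_)
open import Data.Nat using (ℕ; suc; _≤_; _<_; s≤s; _≟_; _<?_; _≤?_)
open import Data.Nat.Properties
open import Data.Product using (Σ; _×_; _,_)
open import Data.Sum using (_⊎_; inj₁; inj₂)
open import Data.Empty using (⊥-elim)
open import Relation.Nullary using (yes; no)
open import Relation.Binary.Bundles using (StrictTotalOrder)
open import Relation.Binary.Definitions using (tri<; tri≈; tri>)
open import Relation.Binary.PropositionalEquality using (_≡_; _≢_; refl; ≢-sym)

module _ {a ℓ₁ ℓ₂ : Level} (O : StrictTotalOrder a ℓ₁ ℓ₂)
         (A : ℕ → StrictTotalOrder.Carrier O) where
  open StrictTotalOrder O using (asym) renaming (_<_ to _⊏_)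

  LeastIn : ℕ → ℕ → ℕ → Set ℓ₂
  LeastIn lo hi w = ∀ m → lo ≤ m → m < hi → m ≢ w → A w ⊏ A m

  suffixLeast⇒rightSpine : ∀ {lo hi t i w} → IsCartesianTree O A lo hi t →
                           lo ≤ i → i ≤ w → w < hi → LeastIn i hi w → RightSpine t w
  suffixLeast⇒rightSpine (ct-leaf refl) lo≤i i≤w w<hi _ = ⊥-elim (≤⇒≯ (≤-trans lo≤i i≤w) w<hi)
  suffixLeast⇒rightSpine {i = i} {w = w} (ct-node {k = k} _ k<hi kmin _ cr) lo≤i i≤w w<hi wmin
    with k ≟ w | k <? i
  ... | yes refl | _       = rs-here
  ... | no k≢w   | yes k<i = rs-down (suffixLeast⇒rightSpine cr k<i i≤w w<hi wmin)
  ... | no k≢w   | no k≮i  =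
    ⊥-elim (asym (kmin w (≤-trans lo≤i i≤w) w<hi (≢-sym k≢w)) (wmin k (≮⇒≥ k≮i) k<hi k≢w))

  prefixLeast⇒leftSpine : ∀ {lo hi t j w} → IsCartesianTree O A lo hi t →
                          lo ≤ w → w < j → j ≤ hi → LeastIn lo j w → LeftSpine t w
  prefixLeast⇒leftSpine (ct-leaf refl) lo≤w w<j j≤hi _ = ⊥-elim (≤⇒≯ lo≤w (<-≤-trans w<j j≤hi))
  prefixLeast⇒leftSpine {j = j} {w = w} (ct-node {k = k} lo≤k _ kmin cl _) lo≤w w<j j≤hi wmin
    with k ≟ w | j ≤? k
  ... | yes refl | _       = ls-here
  ... | no k≢w   | yes j≤k = ls-down (prefixLeast⇒leftSpine cl lo≤w w<j j≤k wmin)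
  ... | no k≢w   | no j≰k  =
    ⊥-elim (asym (kmin w lo≤w (<-≤-trans w<j j≤hi) (≢-sym k≢w)) (wmin k lo≤k (≰⇒> j≰k) k≢w))

  record SplittingNode (t : Tree) (i j : ℕ) : Set (a ⊔ ℓ₂) where
    constructor splitting
    field
      {lo hi k} : ℕ
      {l r}     : Tree
      subtree   : Subtree (node l k r) t
      cartesian : IsCartesianTree O A lo hi (node l k r)
      lo≤i      : lo ≤ i
      i≤k       : i ≤ k
      k≤j       : k ≤ j
      j<hi      : j < hi

  mapSubtree : ∀ {t t′ i j} → (∀ {s} → Subtree s t → Subtree s t′) →
               SplittingNode t i j → SplittingNode t′ i j
  mapSubtree f (splitting st ct lo≤i i≤k k≤j j<hi) = splitting (f st) ct lo≤i i≤k k≤j j<hi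

  splittingNode : ∀ {lo hi t i j} → IsCartesianTree O A lo hi t →
                  lo ≤ i → i ≤ j → j < hi → SplittingNode t i j
  splittingNode (ct-leaf refl) lo≤i i≤j j<hi = ⊥-elim (≤⇒≯ (≤-trans lo≤i i≤j) j<hi)
  splittingNode {i = i} {j = j} ct@(ct-node {k = k} _ _ _ cl cr) lo≤i i≤j j<hi with k <? i | j <? k
  ... | yes k<i | _       = mapSubtree right (splittingNode cr k<i i≤j j<hi)
  ... | no _    | yes j<k = mapSubtree left (splittingNode cl lo≤i i≤j j<k)
  ... | no k≮i  | no j≮k  = splitting here ct lo≤i (≮⇒≥ k≮i) (≮⇒≥ j≮k) j<hi

  splittingRoot≡rmq : ∀ {lo hi l k r i j v} → IsCartesianTree O A lo hi (node l k r) →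
                      lo ≤ i → i ≤ k → k ≤ j → j < hi → IsRMQ O A i j v → k ≡ v
  splittingRoot≡rmq {k = k} {v = v} (ct-node _ _ kmin _ _) lo≤i i≤k k≤j j<hi (i≤v , v≤j , vmin)
    with k ≟ v
  ... | yes k≡v = k≡v
  ... | no k≢v  = ⊥-elim (asym (vmin k i≤k k≤j k≢v)
                               (kmin v (≤-trans lo≤i i≤v) (≤-<-trans v≤j j<hi) (≢-sym k≢v)))

  r2m-onInnerSpine : ∀ {lo hi l k r i j w} → IsCartesianTree O A lo hi (node l k r) →
                     lo ≤ i → i ≤ k → k ≤ j → j < hi → IsR2M O A i j w →
                     RightSpine l w ⊎ LeftSpine r w
  r2m-onInnerSpine {k = k} {w = w} ct@(ct-node _ _ _ cl cr) lo≤i i≤k k≤j j<hi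
                   (i≤w , w≤j , _ , rmq , w≢v , wmin)
    with splittingRoot≡rmq ct lo≤i i≤k k≤j j<hi rmq
  ... | refl with <-cmp w k
  ...   | tri≈ _ w≡k _ = ⊥-elim (w≢v w≡k)
  ...   | tri< w<k _ _ = inj₁ (suffixLeast⇒rightSpine cl lo≤i i≤w w<k
          λ m i≤m m<k → wmin m i≤m (≤-trans (<⇒≤ m<k) k≤j) (<⇒≢ m<k))
  ...   | tri> _ _ k<w = inj₂ (prefixLeast⇒leftSpine cr k<w (s≤s w≤j) j<hi
          λ m k<m m<1+j → wmin m (≤-trans i≤k (<⇒≤ k<m)) (<⇒≤pred m<1+j) (≢-sym (<⇒≢ k<m)))

lemma4 : ∀ {a ℓ₁ ℓ₂ : Level} (O : StrictTotalOrder a ℓ₁ ℓ₂)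
           (n : ℕ) (A : ℕ → StrictTotalOrder.Carrier O) →
           Distinct O n A →
           (T : Tree) → IsCartesianTree O A 1 (suc n) T →
           (i j v w : ℕ) → 1 ≤ i → i < j → j ≤ n →
           IsRMQ O A i j v → IsR2M O A i j w →
           Σ Tree (λ s → Subtree s T × RootIs s v ×
                         (LeftInnerSpine s w ⊎ RightInnerSpine s w))
lemma4 O n A _ T ct i j v w 1≤i i<j j≤n rmq r2m
  with splittingNode O A ct 1≤i (<⇒≤ i<j) (s≤s j≤n)
... | splitting {k = k} {l} {r} st split lo≤i i≤k k≤j j<hi =
  node l k r , st ,
  splittingRoot≡rmq O A split lo≤i i≤k k≤j j<hi rmq ,
  r2m-onInnerSpine O A split lo≤i i≤k k≤j j<hi r2m
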